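{- Let $H$ be a homogeneous relation on $X=\{1,\dots,n\}$ and $\sigma$ a factoring permutation of $H$. For $i\le j$ let $I_{ij}=\{\sigma(i),\dots,\sigma(j)\}$ and $\mathcal S_{ij}$ its set of splitters; call $I_{ij}$ right-free if $\sigma(k)\notin\mathcal S_{ij}$ for all $k>j$. If $j_1<\dots<j_k$ are such that every $I_{ij_q}$ ($1\le q\le k$) is right-free, then $\mathcal S_{ij_1}\subseteq\mathcal S_{ij_2}\subseteq\dots\subseteq\mathcal S_{ij_k}$.
   Context: A diverse triple of $X$ is $(x,y,z)\in X^3$ with $x\neq y$, $x\neq z$, written $(x|yz)$. A homogeneous relation $H$ on $X$ is a relation on diverse triples such that for every $x\in X$ the relation $H_x(y,z)\Leftrightarrow H(x|yz)$ is an equivalence relation on $X\setminus\{x\}$. A splitter of $A\subseteq X$ is an element $s\in X\setminus A$ with $\neg H(s|yz)$ for some $y,z\in A$. A homogeneous module is a set with no splitter; it is strong if it overlaps (intersects, with both differences non-empty) no other homogeneous module; $X$ and singletons are strong. A factoring permutation of $H$ is the visit order of leaves in a depth-first search of the tree of strong homogeneous modules ordered by inclusion. -}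

module Defs where

open import Data.Nat using (ℕ)
open import Data.Fin using (Fin; _≤_; _<_)
open import Data.Fin.Permutation using (Permutation′; _⟨$⟩ʳ_)
open import Data.Bool using (Bool; true)
open import Data.Product using (Σ; ∃; _×_; _,_)
open import Relation.Binary.PropositionalEquality using (_≡_; _≢_)
open import Relation.Nullary using (¬_)
open import Level using (0ℓ)
open import Relation.Unary using (Pred; _∈_; _∉_; _⊆_)

-- A ternary relation on X = Fin n; H x y z stands for H(x|yz).
-- Only its values on diverse triples (x ≢ y, x ≢ z) matter.
Rel3 : ℕ → Set
Rel3 n = Fin n → Fin n → Fin n → Bool

Holds : ∀ {n} → Rel3 n → Fin n → Fin n → Fin n → Set
Holds H x y z = H x y z ≡ true

record IsHomogeneous {n : ℕ} (H : Rel3 n) : Set where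
  field
    reflH  : ∀ x y → x ≢ y → Holds H x y y
    symH   : ∀ x y z → x ≢ y → x ≢ z → Holds H x y z → Holds H x z y
    transH : ∀ x y z w → x ≢ y → x ≢ z → x ≢ w →
             Holds H x y z → Holds H x z w → Holds H x y w

Subset : ℕ → Set₁
Subset n = Pred (Fin n) 0ℓ

Splitter : ∀ {n} → Rel3 n → Subset n → Fin n → Set
Splitter H A s = s ∉ A × Σ (Fin n) λ y → Σ (Fin n) λ z → y ∈ A × z ∈ A × ¬ Holds H s y z
  where n = _

IsModule : ∀ {n} → Rel3 n → Subset n → Set
IsModule H M = ∀ s → ¬ Splitter H M s

Overlap : ∀ {n} → Subset n → Subset n → Set
Overlap {n} A B =
  (∃ λ (x : Fin n) → x ∈ A × x ∈ B) ×
  (∃ λ (x : Fin n) → x ∈ A × x ∉ B) ×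
  (∃ λ (x : Fin n) → x ∉ A × x ∈ B)

IsStrongModule : ∀ {n} → Rel3 n → Subset n → Set₁
IsStrongModule H M = IsModule H M × (∀ M′ → IsModule H M′ → ¬ Overlap M M′)

-- σ is a factoring permutation: a depth-first leaf order of the tree of
-- strong modules, i.e. every strong module occupies a contiguous block of σ.
IsFactoringPermutation : ∀ {n} → Rel3 n → Permutation′ n → Set₁
IsFactoringPermutation {n} H σ =
  ∀ M → IsStrongModule H M →
  ∀ (i j k : Fin n) → i ≤ j → j ≤ k →
  (σ ⟨$⟩ʳ i) ∈ M → (σ ⟨$⟩ʳ k) ∈ M → (σ ⟨$⟩ʳ j) ∈ M

I : ∀ {n} → Permutation′ n → Fin n → Fin n → Subset n
I {n} σ i j x = Σ (Fin n) λ k → i ≤ k × k ≤ j × σ ⟨$⟩ʳ k ≡ x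

S : ∀ {n} → Rel3 n → Permutation′ n → Fin n → Fin n → Subset n
S H σ i j = Splitter H (I σ i j)

RightFree : ∀ {n} → Rel3 n → Permutation′ n → Fin n → Fin n → Set
RightFree {n} H σ i j = ∀ (k : Fin n) → j < k → (σ ⟨$⟩ʳ k) ∉ S H σ i j

{-# OPTIONS --safe #-}
module Submission where

open import Defs
open import Data.Nat using (ℕ)
open import Data.Fin using (Fin; _≤_; _<_; _≟_)
open import Data.Fin.Permutation using (Permutation′)
open import Relation.Unary using (_⊆_; _∉_)
import Data.Nat.Properties as ℕ
import Data.Fin.Properties as Fin
open import Data.Product using (_,_; proj₁)
open import Relation.Binary.PropositionalEquality using (refl; sym; subst)
open import Relation.Nullary using (yes; no)

-- For j ≤ j′, the witnesses y, z of a splitter s of I_ij also lie in I_ij′, so s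
-- splits I_ij′ unless s ∈ I_ij′, i.e. s = σ(m) with j < m ≤ j′; right-freeness of
-- I_ij excludes exactly that.

strictMono⇒mono : ∀ {k n} (f : Fin k → Fin n) →
                  (∀ p q → p < q → f p < f q) → ∀ {p q} → p ≤ q → f p ≤ f q
strictMono⇒mono f mono {p} {q} p≤q with p ≟ q
... | yes refl = Fin.≤-refl
... | no p≢q   = ℕ.<⇒≤ (mono p q (Fin.≤∧≢⇒< p≤q p≢q))

I-monoʳ : ∀ {n} (σ : Permutation′ n) (i : Fin n) {j j′ : Fin n} →
          j ≤ j′ → I σ i j ⊆ I σ i j′
I-monoʳ σ i j≤j′ (m , i≤m , m≤j , σm≡x) = m , i≤m , Fin.≤-trans m≤j j≤j′ , σm≡x

Splitter-mono : ∀ {n} (H : Rel3 n) {A B : Subset n} {s : Fin n} →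
                A ⊆ B → s ∉ B → Splitter H A s → Splitter H B s
Splitter-mono H A⊆B s∉B (_ , y , z , y∈A , z∈A , ¬Hsyz) =
  s∉B , y , z , A⊆B y∈A , A⊆B z∈A , ¬Hsyz

RightFree⇒S-monoʳ : ∀ {n} (H : Rel3 n) (σ : Permutation′ n) (i : Fin n) {j j′ : Fin n} →
                    RightFree H σ i j → j ≤ j′ → S H σ i j ⊆ S H σ i j′
RightFree⇒S-monoʳ H σ i {j} {j′} free j≤j′ {x} x∈Sij =
  Splitter-mono H (I-monoʳ σ i j≤j′) x∉Iij′ x∈Sij
  where
  x∉Iij′ : x ∉ I σ i j′
  x∉Iij′ (m , i≤m , m≤j′ , σm≡x) with m Fin.≤? j
  ... | yes m≤j = proj₁ x∈Sij (m , i≤m , m≤j , σm≡x)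
  ... | no m≰j  = free m (ℕ.≰⇒> m≰j) (subst (S H σ i j) (sym σm≡x) x∈Sij)

proposition14 : ∀ {n : ℕ} (H : Rel3 n) → IsHomogeneous H →
    (σ : Permutation′ n) → IsFactoringPermutation H σ →
    (i : Fin n) (k : ℕ) (js : Fin k → Fin n) →
    (∀ p q → p < q → js p < js q) →
    (∀ p → i ≤ js p) →
    (∀ p → RightFree H σ i (js p)) →
    ∀ p q → p ≤ q → S H σ i (js p) ⊆ S H σ i (js q)
proposition14 H _ σ _ i k js mono _ free p q p≤q =
  RightFree⇒S-monoʳ H σ i (free p) (strictMono⇒mono js mono p≤q)
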